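{- Let $b\ge 2$ and $k\ge 1$ be integers. For $\ell=0,\dots,k-1$ let $P_\ell$ be the $1\times(2b-1)$ row $$(1,\,2,\,3,\,\dots,\,b-1,\,0,\,b-1,\,\dots,\,3,\,2,\,1),$$ let $P_k$ be the $1\times(2b-1)$ row that is $1$ in the middle (the $b$-th) position and $0$ elsewhere, and let $T=\sum_{\ell=0}^k b^\ell P_\ell$. Then the largest entry of $T$ is $h=b^k$, and for any segmentations $\mathcal S_0,\dots,\mathcal S_k$ of $P_0,\dots,P_k$ respectively, the segmentation $\mathcal S=\{b^\ell S: S\in\mathcal S_\ell,\ 0\le \ell\le k\}$ of $T$ (counted with multiplicity, so $|\mathcal S|=\sum_\ell|\mathcal S_\ell|$) satisfies $$|\mathcal S|\ \ge\ \left(\frac{2b-2}{b}\cdot\log_b h+\frac1b\right)\cdot OPT(T),$$ where $OPT(T)$ is the minimum size of a segmentation of $T$. (Note that $P_0,\dots,P_k$ are exactly the matrices of base-$b$ digits of $T$, i.e. the unique matrices with entries in $\{0,\dots,b-1\}$ with $T=\sum_\ell b^\ell P_\ell$.)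
   Context: A segment of a $1\times n$ row of non-negative integers is a $1\times n$ row with non-negative integer entries whose non-zero entries all equal the same positive integer (the segment-value) and occupy consecutive positions. A segmentation of a row $R$ is a finite multiset of segments summing to $R$; its size is the number of segments. For a segment $S$ with value $v$ and a positive integer $c$, $cS$ is a segment with value $cv$. -}

module Defs where

open import Data.Nat using (ℕ; zero; suc; _+_; _*_; _∸_; _^_; _≤_; _<_; _<ᵇ_; _≡ᵇ_)
open import Data.Fin using (Fin; toℕ)
import Data.Fin as Fin
open import Data.List using (List; []; _∷_; map; concat; length; allFin)
open import Data.List.Relation.Unary.All using (All)
open import Data.Product using (Σ; ∃; _×_; _,_)
open import Data.Sum using (_⊎_)
open import Relation.Nullary using (¬_)
open import Data.Bool using (if_then_else_)
open import Relation.Binary.PropositionalEquality using (_≡_)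

Row : ℕ → Set
Row n = Fin n → ℕ

IsSegment : {n : ℕ} → Row n → Set
IsSegment {n} S =
  Σ ℕ λ v → (0 < v) × (Σ ℕ λ i → Σ ℕ λ j → (i ≤ j) × (j < n) ×
    (∀ (p : Fin n) → ((i ≤ toℕ p) × (toℕ p ≤ j) × (S p ≡ v))
                      ⊎ ((¬ ((i ≤ toℕ p) × (toℕ p ≤ j))) × (S p ≡ 0))))

sumRows : {n : ℕ} → List (Row n) → Row n
sumRows []       p = 0
sumRows (S ∷ Ss) p = S p + sumRows Ss p

IsSegmentation : {n : ℕ} → Row n → List (Row n) → Set
IsSegmentation R L = All IsSegment L × (∀ p → sumRows L p ≡ R p)

size : {n : ℕ} → List (Row n) → ℕ
size = length

scale : {n : ℕ} → ℕ → Row n → Row n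
scale c S p = c * S p

IsOptimalSegmentation : {n : ℕ} → Row n → List (Row n) → Set
IsOptimalSegmentation R L =
  IsSegmentation R L × (∀ L' → IsSegmentation R L' → size L ≤ size L')

width : ℕ → ℕ
width b = 2 * b ∸ 1

-- (1,2,...,b-1,0,b-1,...,2,1): position q (0-indexed)
tentRow : (b : ℕ) → Row (width b)
tentRow b p =
  if toℕ p <ᵇ (b ∸ 1) then suc (toℕ p)
  else if toℕ p ≡ᵇ (b ∸ 1) then 0
  else width b ∸ toℕ p

spikeRow : (b : ℕ) → Row (width b)
spikeRow b p = if toℕ p ≡ᵇ (b ∸ 1) then 1 else 0

P : (b k : ℕ) → Fin (suc k) → Row (width b)
P b k ℓ = if toℕ ℓ ≡ᵇ k then spikeRow b else tentRow b

sumFin : (m : ℕ) → (Fin m → ℕ) → ℕ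
sumFin zero    f = 0
sumFin (suc m) f = f Fin.zero + sumFin m (λ i → f (Fin.suc i))

T : (b k : ℕ) → Row (width b)
T b k p = sumFin (suc k) (λ ℓ → b ^ toℕ ℓ * P b k ℓ p)

combine : (b k : ℕ) → (Fin (suc k) → List (Row (width b))) → List (Row (width b))
combine b k Ss = concat (map (λ ℓ → map (scale (b ^ toℕ ℓ)) (Ss ℓ)) (allFin (suc k)))

module Submission where

-- Write b = suc a: rows have width 2a+1, the centre is position a, the tent row reads
-- 1,2,…,a,0,a,…,2,1, and r = 1 + b + ⋯ + b^(k-1) is the repunit, so r·a + 1 = b^k.
--  (1) Summing digits, T(x) = r·tent(x) + b^k·spike(x): off the centre T(x) ≤ r·a < b^k,
--      and T(a) = b^k, so the largest entry is h = b^k.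
--  (2) OPT(T) ≤ b: the segments "height 1 on {a}" and "height r on [i, a+1+i]" (i < a)
--      sum to T, since exactly min(x+1, a, 2a+1-x) of the latter contain x.
--  (3) |𝒮| ≥ 2a·k + 1: where the tent rises (x < a) some segment of a segmentation starts,
--      where it falls (a+1+z, z < a) some segment ends, and since the centre entry is 0 no
--      segment does both; so a tent needs 2a segments, and the spike needs one.
--  (4) Scaling by b^ℓ keeps segments, so 𝒮 segments T and
--      ((2b-2)k + 1)·OPT(T) ≤ (2a·k + 1)·b ≤ b·|𝒮|.

open import Defs
open import Data.Nat using (ℕ; zero; suc; _+_; _*_; _∸_; _^_; _≤_; _<_; _<ᵇ_; _≡ᵇ_;
  z≤n; s≤s; _≤?_; _≟_; _<?_; NonZero)
open import Data.Nat.Properties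
open import Data.Fin using (Fin; toℕ; fromℕ<)
import Data.Fin as Fin
open import Data.Fin.Properties using (toℕ-fromℕ<)
open import Data.List using (List; []; _∷_; map; concat; length; tabulate; _++_)
open import Data.List.Properties using (map-tabulate; length-++; length-map)
open import Data.List.Relation.Unary.All using (All; []; _∷_) renaming (map to All-map)
open import Data.List.Relation.Unary.All.Properties using (concat⁺; tabulate⁺; map⁺)
open import Data.Product using (Σ; ∃; _×_; _,_; proj₁; proj₂)
open import Data.Sum using (_⊎_; inj₁; inj₂)
open import Data.Bool using (Bool; true; false; if_then_else_)
open import Data.Bool.Properties using (T-≡; ¬-not)
open import Function using (_∘_)
open import Function.Bundles using (Equivalence)
open import Relation.Nullary using (¬_; yes; no; contradiction)
open import Relation.Binary.PropositionalEquality
open import Relation.Binary.Definitions using (tri<; tri≈; tri>)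
open import Algebra.Properties.CommutativeSemigroup +-commutativeSemigroup using (interchange)
open import Data.Nat.Solver using (module +-*-Solver)
open +-*-Solver using (solve; _:=_; con; _:+_; _:*_)

<ᵇ-true : ∀ {m n} → m < n → (m <ᵇ n) ≡ true
<ᵇ-true m<n = Equivalence.to T-≡ (<⇒<ᵇ m<n)

<ᵇ-false : ∀ {m n} → n ≤ m → (m <ᵇ n) ≡ false
<ᵇ-false {m} {n} n≤m = ¬-not (λ t → <⇒≱ (<ᵇ⇒< m n (Equivalence.from T-≡ t)) n≤m)

≡ᵇ-true : ∀ n → (n ≡ᵇ n) ≡ true
≡ᵇ-true n = Equivalence.to T-≡ (≡⇒≡ᵇ n n refl)

≡ᵇ-false : ∀ {m n} → m ≢ n → (m ≡ᵇ n) ≡ false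
≡ᵇ-false {m} {n} m≢n = ¬-not (λ t → m≢n (≡ᵇ⇒≡ m n (Equivalence.from T-≡ t)))

𝟙[_≤_] : ℕ → ℕ → ℕ
𝟙[ m ≤ n ] with m ≤? n
... | yes _ = 1
... | no _  = 0

𝟙≤-yes : ∀ {m n} → m ≤ n → 𝟙[ m ≤ n ] ≡ 1
𝟙≤-yes {m} {n} m≤n with m ≤? n
... | yes _   = refl
... | no  m≰n = contradiction m≤n m≰n

𝟙≤-no : ∀ {m n} → ¬ m ≤ n → 𝟙[ m ≤ n ] ≡ 0
𝟙≤-no {m} {n} m≰n with m ≤? n
... | yes m≤n = contradiction m≤n m≰n
... | no  _   = refl

𝟙≤-shift : ∀ c m n → 𝟙[ c + m ≤ c + n ] ≡ 𝟙[ m ≤ n ]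
𝟙≤-shift c m n with m ≤? n
... | yes m≤n = 𝟙≤-yes (+-monoʳ-≤ c m≤n)
... | no  m≰n = 𝟙≤-no (λ le → m≰n (+-cancelˡ-≤ c m n le))

𝟙[_≡_] : ℕ → ℕ → ℕ
𝟙[ m ≡ n ] with m ≟ n
... | yes _ = 1
... | no _  = 0

𝟙≡-yes : ∀ {m n} → m ≡ n → 𝟙[ m ≡ n ] ≡ 1
𝟙≡-yes {m} {n} m≡n with m ≟ n
... | yes _   = refl
... | no  m≢n = contradiction m≡n m≢n

𝟙≡-no : ∀ {m n} → m ≢ n → 𝟙[ m ≡ n ] ≡ 0
𝟙≡-no {m} {n} m≢n with m ≟ n
... | yes m≡n = contradiction m≡n m≢n
... | no  _   = refl

𝟙≡-zero⇒≢ : ∀ {m n} → 𝟙[ m ≡ n ] ≡ 0 → m ≢ n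
𝟙≡-zero⇒≢ none m≡n = contradiction (trans (sym (𝟙≡-yes m≡n)) none) (λ ())

box : ℕ → ℕ → ℕ → ℕ → ℕ
box v i j x = v * (𝟙[ i ≤ x ] * 𝟙[ x ≤ j ])

box-inside : ∀ v {i j x} → i ≤ x → x ≤ j → box v i j x ≡ v
box-inside v {i} {j} {x} i≤x x≤j with i ≤? x | x ≤? j
... | yes _   | yes _  = *-identityʳ v
... | yes _   | no x≰j = contradiction x≤j x≰j
... | no i≰x  | _      = contradiction i≤x i≰x

box-outside : ∀ v {i j x} → ¬ (i ≤ x × x ≤ j) → box v i j x ≡ 0
box-outside v {i} {j} {x} x∉ with i ≤? x | x ≤? j
... | yes i≤x | yes x≤j = contradiction (i≤x , x≤j) x∉
... | yes _   | no _    = *-zeroʳ v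
... | no _    | _       = *-zeroʳ v

-- The dichotomy that Defs.IsSegment demands of each entry of a segment.
box-shape : ∀ v i j x →
  ((i ≤ x) × (x ≤ j) × (box v i j x ≡ v)) ⊎ ((¬ ((i ≤ x) × (x ≤ j))) × (box v i j x ≡ 0))
box-shape v i j x with i ≤? x | x ≤? j
... | yes i≤x | yes x≤j = inj₁ (i≤x , x≤j , *-identityʳ v)
... | yes _   | no x≰j  = inj₂ (x≰j ∘ proj₂ , *-zeroʳ v)
... | no i≰x  | _       = inj₂ (i≰x ∘ proj₁ , *-zeroʳ v)

sumBelow : ℕ → (ℕ → ℕ) → ℕ
sumBelow zero    f = 0
sumBelow (suc n) f = f n + sumBelow n f

sumBelow-ext : ∀ n {f g} → (∀ i → i < n → f i ≡ g i) → sumBelow n f ≡ sumBelow n g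
sumBelow-ext zero    f≡g = refl
sumBelow-ext (suc n) f≡g = cong₂ _+_ (f≡g n ≤-refl) (sumBelow-ext n (λ i i<n → f≡g i (m<n⇒m<1+n i<n)))

sumBelow-zero : ∀ n → sumBelow n (λ _ → 0) ≡ 0
sumBelow-zero zero    = refl
sumBelow-zero (suc n) = sumBelow-zero n

sumBelow-+ : ∀ n f g → sumBelow n (λ i → f i + g i) ≡ sumBelow n f + sumBelow n g
sumBelow-+ zero    f g = refl
sumBelow-+ (suc n) f g = trans (cong (f n + g n +_) (sumBelow-+ n f g))
                               (interchange (f n) (g n) (sumBelow n f) (sumBelow n g))

sumBelow-≥ : ∀ n f → (∀ i → i < n → 1 ≤ f i) → n ≤ sumBelow n f
sumBelow-≥ zero    f pos = z≤n
sumBelow-≥ (suc n) f pos = +-mono-≤ (pos n ≤-refl) (sumBelow-≥ n f (λ i i<n → pos i (m<n⇒m<1+n i<n)))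

count-≤-all : ∀ n m → n ≤ suc m → sumBelow n (λ i → 𝟙[ i ≤ m ]) ≡ n
count-≤-all zero    m _         = refl
count-≤-all (suc n) m (s≤s n≤m) rewrite 𝟙≤-yes n≤m = cong suc (count-≤-all n m (m≤n⇒m≤1+n n≤m))

count-≤-cut : ∀ n m → m < n → sumBelow n (λ i → 𝟙[ i ≤ m ]) ≡ suc m
count-≤-cut (suc n) m (s≤s m≤n) with m≤n⇒m<n∨m≡n m≤n
... | inj₁ m<n  rewrite 𝟙≤-no (<⇒≱ m<n) = count-≤-cut n m m<n
... | inj₂ refl rewrite 𝟙≤-yes (≤-refl {m}) = cong suc (count-≤-all m m (n≤1+n m))

count-≥ : ∀ n z → sumBelow n (λ i → 𝟙[ z ≤ i ]) ≡ n ∸ z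
count-≥ zero    z = sym (0∸n≡0 z)
count-≥ (suc n) z with z ≤? n
... | yes z≤i = trans (cong suc (count-≥ n z)) (sym (+-∸-assoc 1 z≤i))
... | no  z≰i = trans (count-≥ n z) (trans (m≤n⇒m∸n≡0 (≰⇒≥ z≰i)) (sym (m≤n⇒m∸n≡0 (≰⇒> z≰i))))

hits-above : ∀ c j n → c + n ≤ j → sumBelow n (λ y → 𝟙[ j ≡ c + y ]) ≡ 0
hits-above c j zero    _   = refl
hits-above c j (suc n) c+n<j rewrite +-suc c n =
  cong₂ _+_ (𝟙≡-no (λ e → <⇒≢ c+n<j (sym e))) (hits-above c j n (<⇒≤ c+n<j))

hits-below : ∀ c j n → j < c → sumBelow n (λ y → 𝟙[ j ≡ c + y ]) ≡ 0
hits-below c j zero    _   = refl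
hits-below c j (suc n) j<c =
  cong₂ _+_ (𝟙≡-no (λ e → <⇒≢ (<-≤-trans j<c (m≤m+n c n)) e)) (hits-below c j n j<c)

hits-≤1 : ∀ c j n → sumBelow n (λ y → 𝟙[ j ≡ c + y ]) ≤ 1
hits-≤1 c j zero    = z≤n
hits-≤1 c j (suc n) with j ≟ c + n
... | yes j≡c+n = ≤-reflexive (cong suc (hits-above c j n (≤-reflexive (sym j≡c+n))))
... | no  _     = hits-≤1 c j n

sumFin-ext : ∀ m {f g : Fin m → ℕ} → (∀ i → f i ≡ g i) → sumFin m f ≡ sumFin m g
sumFin-ext zero    f≡g = refl
sumFin-ext (suc m) f≡g = cong₂ _+_ (f≡g Fin.zero) (sumFin-ext m (f≡g ∘ Fin.suc))

sumFin-mono : ∀ m {f g : Fin m → ℕ} → (∀ i → f i ≤ g i) → sumFin m f ≤ sumFin m g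
sumFin-mono zero    f≤g = z≤n
sumFin-mono (suc m) f≤g = +-mono-≤ (f≤g Fin.zero) (sumFin-mono m (f≤g ∘ Fin.suc))

sumFin-scale : ∀ m c (f : Fin m → ℕ) → sumFin m (λ i → c * f i) ≡ c * sumFin m f
sumFin-scale zero    c f = sym (*-zeroʳ c)
sumFin-scale (suc m) c f = trans (cong (c * f Fin.zero +_) (sumFin-scale m c (f ∘ Fin.suc)))
                                 (sym (*-distribˡ-+ c (f Fin.zero) _))

tent : ℕ → ℕ → ℕ
tent a x = if x <ᵇ a then suc x else (if x ≡ᵇ a then 0 else width (suc a) ∸ x)

spike : ℕ → ℕ → ℕ
spike a x = if x ≡ᵇ a then 1 else 0

width-suc : ∀ a → width (suc a) ≡ suc a + a
width-suc a rewrite +-identityʳ a = +-suc a a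

middle<width : ∀ a → a < width (suc a)
middle<width a = subst (a <_) (sym (width-suc a)) (s≤s (m≤n+m a a))

middle : ∀ a → Fin (width (suc a))
middle a = fromℕ< (middle<width a)

data Position (a : ℕ) : ℕ → Set where
  left   : ∀ {x} → x < a → Position a x
  centre : Position a a
  right  : ∀ z → Position a (suc a + z)

position : ∀ a x → Position a x
position a x with <-cmp x a
... | tri< x<a _    _   = left x<a
... | tri≈ _   refl _   = centre
... | tri> _   _    a<x = subst (Position a) (m+[n∸m]≡n a<x) (right (x ∸ suc a))

tent-left : ∀ a x → x < a → tent a x ≡ suc x
tent-left a x x<a rewrite <ᵇ-true x<a = refl

tent-centre : ∀ a → tent a a ≡ 0
tent-centre a rewrite <ᵇ-false (≤-refl {a}) | ≡ᵇ-true a = refl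

tent-right : ∀ a z → tent a (suc a + z) ≡ a ∸ z
tent-right a z rewrite <ᵇ-false (m≤n⇒m≤1+n (m≤m+n a z))
                     | ≡ᵇ-false (<⇒≢ (s≤s (m≤m+n a z)) ∘ sym)
                     | width-suc a = [m+n]∸[m+o]≡n∸o (suc a) a z

tent-beyond : ∀ a x → width (suc a) ≤ x → tent a x ≡ 0
tent-beyond a x w≤x with position a x
... | left x<a = contradiction (<-trans x<a (middle<width a)) (≤⇒≯ w≤x)
... | centre   = contradiction (middle<width a) (≤⇒≯ w≤x)
... | right z  = trans (tent-right a z)
  (m≤n⇒m∸n≡0 (+-cancelˡ-≤ (suc a) a z (subst (_≤ suc a + z) (width-suc a) w≤x)))

spike-centre : ∀ a → spike a a ≡ 1
spike-centre a rewrite ≡ᵇ-true a = refl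

spike-off : ∀ a x → x ≢ a → spike a x ≡ 0
spike-off a x x≢a rewrite ≡ᵇ-false x≢a = refl

repunit : ℕ → ℕ → ℕ
repunit b zero    = 0
repunit b (suc k) = 1 + b * repunit b k

repunit-spec : ∀ a k → repunit (suc a) k * a + 1 ≡ suc a ^ k
repunit-spec a zero    = refl
repunit-spec a (suc k) = begin
  (1 + suc a * r) * a + 1   ≡⟨ solve 2 (λ r a → (con 1 :+ (con 1 :+ a) :* r) :* a :+ con 1
                                         := (con 1 :+ a) :* (r :* a :+ con 1)) refl r a ⟩
  suc a * (r * a + 1)       ≡⟨ cong (suc a *_) (repunit-spec a k) ⟩
  suc a * suc a ^ k         ∎
  where open ≡-Reasoning
        r = repunit (suc a) k

digit-sum : ∀ {X : Set} b (A B : X → ℕ) (p : X) k →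
  sumFin (suc k) (λ ℓ → b ^ toℕ ℓ * (if toℕ ℓ ≡ᵇ k then A else B) p)
    ≡ repunit b k * B p + b ^ k * A p
digit-sum b A B p zero    = +-identityʳ _
digit-sum b A B p (suc k) = begin
  1 * B p + sumFin (suc k) (λ ℓ → b * b ^ toℕ ℓ * C ℓ)
    ≡⟨ cong (1 * B p +_) (trans (sumFin-ext (suc k) (λ ℓ → *-assoc b (b ^ toℕ ℓ) (C ℓ)))
                                (sumFin-scale (suc k) b (λ ℓ → b ^ toℕ ℓ * C ℓ))) ⟩
  1 * B p + b * sumFin (suc k) (λ ℓ → b ^ toℕ ℓ * C ℓ)
    ≡⟨ cong (λ s → 1 * B p + b * s) (digit-sum b A B p k) ⟩
  1 * B p + b * (repunit b k * B p + b ^ k * A p)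
    ≡⟨ solve 5 (λ b x y r bk → con 1 :* y :+ b :* (r :* y :+ bk :* x)
                               := (con 1 :+ b :* r) :* y :+ (b :* bk) :* x)
               refl b (A p) (B p) (repunit b k) (b ^ k) ⟩
  (1 + b * repunit b k) * B p + b * b ^ k * A p ∎
  where open ≡-Reasoning
        C : Fin (suc k) → ℕ
        C ℓ = (if toℕ ℓ ≡ᵇ k then A else B) p

level : ℕ → ℕ → ℕ → ℕ
level a k x = repunit (suc a) k * tent a x + suc a ^ k * spike a x

T-closed : ∀ a k (p : Fin (width (suc a))) → T (suc a) k p ≡ level a k (toℕ p)
T-closed a k p = digit-sum (suc a) (spikeRow (suc a)) (tentRow (suc a)) p k

level-centre : ∀ a k → level a k a ≡ suc a ^ k
level-centre a k rewrite tent-centre a | spike-centre a | *-zeroʳ (repunit (suc a) k) =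
  *-identityʳ (suc a ^ k)

level-off-centre : ∀ a k y → y ≢ a → level a k y ≡ repunit (suc a) k * tent a y
level-off-centre a k y y≢a = begin
  r * tent a y + suc a ^ k * spike a y ≡⟨ cong (λ s → r * tent a y + suc a ^ k * s) (spike-off a y y≢a) ⟩
  r * tent a y + suc a ^ k * 0         ≡⟨ cong (r * tent a y +_) (*-zeroʳ (suc a ^ k)) ⟩
  r * tent a y + 0                     ≡⟨ +-identityʳ _ ⟩
  r * tent a y                         ∎
  where open ≡-Reasoning
        r = repunit (suc a) k

level-off-centre-bound : ∀ a k y → tent a y ≤ a → y ≢ a → level a k y ≤ suc a ^ k
level-off-centre-bound a k y t≤a y≢a = begin
  level a k y   ≡⟨ level-off-centre a k y y≢a ⟩
  r * tent a y  ≤⟨ *-monoʳ-≤ r t≤a ⟩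
  r * a         ≤⟨ m≤m+n (r * a) 1 ⟩
  r * a + 1     ≡⟨ repunit-spec a k ⟩
  suc a ^ k     ∎
  where open ≤-Reasoning
        r = repunit (suc a) k

level-bound : ∀ a k x → level a k x ≤ suc a ^ k
level-bound a k x with position a x
... | left x<a = level-off-centre-bound a k x (≤-trans (≤-reflexive (tent-left a x x<a)) x<a) (<⇒≢ x<a)
... | centre   = ≤-reflexive (level-centre a k)
... | right z  = level-off-centre-bound a k (suc a + z) (≤-trans (≤-reflexive (tent-right a z)) (m∸n≤m a z))
                                  (<⇒≢ (s≤s (m≤m+n a z)) ∘ sym)

-- An explicit segmentation of T with b segments, bounding OPT(T).

seg : ∀ {w} → ℕ → ℕ → ℕ → Row w
seg v i j p = box v i j (toℕ p)

seg-isSegment : ∀ {w} v i j → 0 < v → i ≤ j → j < w → IsSegment (seg {w} v i j)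
seg-isSegment v i j v>0 i≤j j<w = v , v>0 , i , j , i≤j , j<w , λ p → box-shape v i j (toℕ p)

stairs : (a g n : ℕ) → List (Row (width (suc a)))
stairs a g zero    = []
stairs a g (suc n) = seg g n (suc a + n) ∷ stairs a g n

stairs-length : ∀ a g n → length (stairs a g n) ≡ n
stairs-length a g zero    = refl
stairs-length a g (suc n) = cong suc (stairs-length a g n)

stairs-segments : ∀ a g n → 0 < g → n ≤ a → All IsSegment (stairs a g n)
stairs-segments a g zero    g>0 _   = []
stairs-segments a g (suc n) g>0 n<a =
  seg-isSegment g n (suc a + n) g>0 (m≤n+m n (suc a))
                (subst (suc a + n <_) (sym (width-suc a)) (+-monoʳ-< (suc a) n<a))
  ∷ stairs-segments a g n g>0 (<⇒≤ n<a)

stairs-sum : ∀ a g n (p : Fin (width (suc a))) →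
  sumRows (stairs a g n) p ≡ g * sumBelow n (λ i → 𝟙[ i ≤ toℕ p ] * 𝟙[ toℕ p ≤ suc a + i ])
stairs-sum a g zero    p = sym (*-zeroʳ g)
stairs-sum a g (suc n) p = trans (cong (seg g n (suc a + n) p +_) (stairs-sum a g n p))
                                 (sym (*-distribˡ-+ g _ _))

-- roof a x: the number of intervals [i, a+1+i], i < a, containing x; it is the profile
-- 1,2,…,a,a,a,…,2,1.
roof : ℕ → ℕ → ℕ
roof a x = sumBelow a (λ i → 𝟙[ i ≤ x ] * 𝟙[ x ≤ suc a + i ])

-- Up to the centre every interval reaches x, so only the left ends matter.
roof-up-to-centre : ∀ a x → x ≤ a → roof a x ≡ sumBelow a (λ i → 𝟙[ i ≤ x ])
roof-up-to-centre a x x≤a = sumBelow-ext a (λ i _ →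
  trans (cong (𝟙[ i ≤ x ] *_) (𝟙≤-yes (≤-trans x≤a (m≤n⇒m≤1+n (m≤m+n a i))))) (*-identityʳ _))

roof-left : ∀ a x → x < a → roof a x ≡ suc x
roof-left a x x<a = trans (roof-up-to-centre a x (<⇒≤ x<a)) (count-≤-cut a x x<a)

roof-centre : ∀ a → roof a a ≡ a
roof-centre a = trans (roof-up-to-centre a a ≤-refl) (count-≤-all a a (n≤1+n a))

-- Right of the centre every interval starts before x, so only the right ends matter.
roof-right : ∀ a z → roof a (suc a + z) ≡ a ∸ z
roof-right a z = trans (sumBelow-ext a (λ i i<a →
  trans (cong₂ _*_ (𝟙≤-yes (≤-trans (<⇒≤ i<a) (m≤n⇒m≤1+n (m≤m+n a z)))) (𝟙≤-shift (suc a) z i))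
        (*-identityˡ _))) (count-≥ a z)

level-decomposition : ∀ a k x → box 1 a a x + repunit (suc a) k * roof a x ≡ level a k x
level-decomposition a k x with position a x
... | left x<a = trans
  (cong₂ _+_ (box-outside 1 {a} {a} {x} (λ r → <⇒≱ x<a (proj₁ r)))
             (cong (repunit (suc a) k *_) (trans (roof-left a x x<a) (sym (tent-left a x x<a)))))
  (sym (level-off-centre a k x (<⇒≢ x<a)))
... | centre   = trans
  (cong₂ _+_ (box-inside 1 (≤-refl {a}) ≤-refl) (cong (repunit (suc a) k *_) (roof-centre a)))
  (trans (+-comm 1 _) (trans (repunit-spec a k) (sym (level-centre a k))))
... | right z  = trans
  (cong₂ _+_ (box-outside 1 {a} {a} {suc a + z} (λ r → <⇒≱ (s≤s (m≤m+n a z)) (proj₂ r)))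
             (cong (repunit (suc a) k *_) (trans (roof-right a z) (sym (tent-right a z)))))
  (sym (level-off-centre a k (suc a + z) (<⇒≢ (s≤s (m≤m+n a z)) ∘ sym)))

-- For k ≥ 1 (so the staircase height is positive) this is a segmentation of T of size b.
explicit-segmentation : ∀ a k → 1 ≤ k →
  IsSegmentation (T (suc a) k) (seg 1 a a ∷ stairs a (repunit (suc a) k) a)
explicit-segmentation a (suc k) _ =
  (seg-isSegment 1 a a (s≤s z≤n) ≤-refl (middle<width a) ∷ stairs-segments a _ a (s≤s z≤n) ≤-refl) ,
  λ p → trans (cong (seg 1 a a p +_) (stairs-sum a _ a p))
              (trans (level-decomposition a (suc k) (toℕ p)) (sym (T-closed a (suc k) p)))

explicit-size : ∀ a g → length (seg 1 a a ∷ stairs a g a) ≡ suc a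
explicit-size a g = cong suc (stairs-length a g a)

-- Segments as intervals: a profile rises only at a start and falls only after an end.

record Interval (w : ℕ) : Set where
  constructor interval
  field
    height first last : ℕ
    height>0          : 0 < height
    last<w            : last < w

profile : ∀ {w} → List (Interval w) → ℕ → ℕ
profile []                        x = 0
profile (interval v i j _ _ ∷ D) x = box v i j x + profile D x

starts : ∀ {w} → List (Interval w) → ℕ → ℕ
starts []                        x = 0
starts (interval _ i _ _ _ ∷ D) x = 𝟙[ i ≡ x ] + starts D x

ends : ∀ {w} → List (Interval w) → ℕ → ℕ
ends []                        x = 0
ends (interval _ _ j _ _ ∷ D) x = 𝟙[ j ≡ x ] + ends D x

segment-entry : ∀ {w} (S : Row w) v i j (p : Fin w) →
  ((i ≤ toℕ p) × (toℕ p ≤ j) × (S p ≡ v)) ⊎ ((¬ ((i ≤ toℕ p) × (toℕ p ≤ j))) × (S p ≡ 0)) →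
  S p ≡ box v i j (toℕ p)
segment-entry S v i j p (inj₁ (i≤p , p≤j , e)) = trans e (sym (box-inside v i≤p p≤j))
segment-entry S v i j p (inj₂ (p∉ , e))        = trans e (sym (box-outside v p∉))

as-intervals : ∀ {w} (L : List (Row w)) → All IsSegment L →
  Σ (List (Interval w)) λ D → (length D ≡ length L) × (∀ p → sumRows L p ≡ profile D (toℕ p))
as-intervals [] [] = [] , refl , λ p → refl
as-intervals (S ∷ L) ((v , v>0 , i , j , _ , j<w , shape) ∷ segs) with as-intervals L segs
... | D , len≡ , sum≡ = interval v i j v>0 j<w ∷ D , cong suc len≡ ,
                        λ p → cong₂ _+_ (segment-entry S v i j p (shape p)) (sum≡ p)

profile-beyond : ∀ {w} (D : List (Interval w)) x → w ≤ x → profile D x ≡ 0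
profile-beyond []                          x w≤x = refl
profile-beyond (interval v i j _ j<w ∷ D) x w≤x =
  cong₂ _+_ (box-outside v {i} {j} {x} (λ r → <⇒≱ (<-≤-trans j<w w≤x) (proj₂ r))) (profile-beyond D x w≤x)

before : (ℕ → ℕ) → ℕ → ℕ
before f zero    = 0
before f (suc x) = f x

box-no-start : ∀ v i j x → i ≢ x → box v i j x ≤ before (box v i j) x
box-no-start v i j zero    i≢0 = ≤-reflexive (box-outside v {i} {j} {0} (λ r → i≢0 (n≤0⇒n≡0 (proj₁ r))))
box-no-start v i j (suc y) i≢x with box-shape v i j (suc y)
... | inj₂ (_ , e)          = subst (_≤ box v i j y) (sym e) z≤n
... | inj₁ (i≤x , x≤j , e) =
  ≤-reflexive (trans e (sym (box-inside v (≤-pred (≤∧≢⇒< i≤x i≢x)) (≤-trans (n≤1+n y) x≤j))))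

box-no-end : ∀ v i j x → j ≢ x → box v i j x ≤ box v i j (suc x)
box-no-end v i j x j≢x with box-shape v i j x
... | inj₂ (_ , e)          = subst (_≤ box v i j (suc x)) (sym e) z≤n
... | inj₁ (i≤x , x≤j , e) =
  ≤-reflexive (trans e (sym (box-inside v (≤-trans i≤x (n≤1+n x)) (≤∧≢⇒< x≤j (j≢x ∘ sym)))))

profile-no-start : ∀ {w} (D : List (Interval w)) x → starts D x ≡ 0 → profile D x ≤ before (profile D) x
profile-no-start []                        x _    = z≤n
profile-no-start (interval v i j v>0 j<w ∷ D) x none =
  ≤-trans (+-mono-≤ (box-no-start v i j x (𝟙≡-zero⇒≢ (m+n≡0⇒m≡0 _ none)))
                    (profile-no-start D x (m+n≡0⇒n≡0 𝟙[ i ≡ x ] none)))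
          (≤-reflexive (before-+ x))
  where
  before-+ : ∀ x → before (box v i j) x + before (profile D) x ≡ before (profile (interval v i j v>0 j<w ∷ D)) x
  before-+ zero    = refl
  before-+ (suc x) = refl

profile-no-end : ∀ {w} (D : List (Interval w)) x → ends D x ≡ 0 → profile D x ≤ profile D (suc x)
profile-no-end []                        x _    = z≤n
profile-no-end (interval v i j _ _ ∷ D) x none =
  +-mono-≤ (box-no-end v i j x (𝟙≡-zero⇒≢ (m+n≡0⇒m≡0 _ none)))
           (profile-no-end D x (m+n≡0⇒n≡0 𝟙[ j ≡ x ] none))

interval-hits : ∀ a i j → ¬ (i ≤ a × a ≤ j) →
  sumBelow a (λ x → 𝟙[ i ≡ x ]) + sumBelow a (λ z → 𝟙[ j ≡ suc a + z ]) ≤ 1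
interval-hits a i j a∉ with i ≤? a
... | yes i≤a rewrite hits-below (suc a) j a (m<n⇒m<1+n (≰⇒> (λ a≤j → a∉ (i≤a , a≤j))))
                    | +-identityʳ (sumBelow a (λ x → 𝟙[ i ≡ x ])) = hits-≤1 0 i a
... | no  i≰a rewrite hits-above 0 i a (<⇒≤ (≰⇒> i≰a)) = hits-≤1 (suc a) j a

starts-ends-count : ∀ {w} a (D : List (Interval w)) → profile D a ≡ 0 →
  sumBelow a (starts D) + sumBelow a (λ z → ends D (suc a + z)) ≤ length D
starts-ends-count a [] _ = ≤-reflexive (cong₂ _+_ (sumBelow-zero a) (sumBelow-zero a))
starts-ends-count a (interval v i j v>0 _ ∷ D) empty = begin
  sumBelow a (λ x → 𝟙[ i ≡ x ] + starts D x)
    + sumBelow a (λ z → 𝟙[ j ≡ suc a + z ] + ends D (suc a + z))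
    ≡⟨ cong₂ _+_ (sumBelow-+ a _ _) (sumBelow-+ a _ _) ⟩
  (A + A′) + (B + B′)  ≡⟨ interchange A A′ B B′ ⟩
  (A + B) + (A′ + B′)  ≤⟨ +-mono-≤ (interval-hits a i j misses)
                                   (starts-ends-count a D (m+n≡0⇒n≡0 (box v i j a) empty)) ⟩
  1 + length D         ∎
  where
  open ≤-Reasoning
  A  = sumBelow a (λ x → 𝟙[ i ≡ x ])
  A′ = sumBelow a (starts D)
  B  = sumBelow a (λ z → 𝟙[ j ≡ suc a + z ])
  B′ = sumBelow a (λ z → ends D (suc a + z))
  misses : ¬ (i ≤ a × a ≤ j)
  misses (i≤a , a≤j) = <⇒≢ v>0 (sym (trans (sym (box-inside v i≤a a≤j)) (m+n≡0⇒m≡0 _ empty)))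

tent-rises : ∀ {w} a (D : List (Interval w)) → (∀ x → profile D x ≡ tent a x) →
  ∀ x → x < a → 1 ≤ starts D x
tent-rises a D is-tent x x<a = n≢0⇒n>0 (λ none → <⇒≱ (rise x x<a) (profile-no-start D x none))
  where
  rise : ∀ x → x < a → before (profile D) x < profile D x
  rise zero    0<a   = subst (0 <_) (sym (trans (is-tent 0) (tent-left a 0 0<a))) (s≤s z≤n)
  rise (suc y) 1+y<a = subst₂ _<_ (sym (trans (is-tent y) (tent-left a y (<⇒≤ 1+y<a))))
                                  (sym (trans (is-tent (suc y)) (tent-left a (suc y) 1+y<a)))
                                  (n<1+n (suc y))

tent-falls : ∀ {w} a (D : List (Interval w)) → (∀ x → profile D x ≡ tent a x) →
  ∀ z → z < a → 1 ≤ ends D (suc a + z)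
tent-falls a D is-tent z z<a = n≢0⇒n>0 (λ none → <⇒≱ fall (profile-no-end D (suc a + z) none))
  where
  fall : profile D (suc (suc a + z)) < profile D (suc a + z)
  fall = subst₂ _<_ (sym (trans (cong (profile D) (sym (+-suc (suc a) z)))
                                (trans (is-tent (suc a + suc z)) (tent-right a (suc z)))))
                    (sym (trans (is-tent (suc a + z)) (tent-right a z)))
                    (∸-monoʳ-< (n<1+n z) z<a)

tent-intervals : ∀ {w} a (D : List (Interval w)) → (∀ x → profile D x ≡ tent a x) → a + a ≤ length D
tent-intervals a D is-tent =
  ≤-trans (+-mono-≤ (sumBelow-≥ a (starts D) (tent-rises a D is-tent))
                    (sumBelow-≥ a (λ z → ends D (suc a + z)) (tent-falls a D is-tent)))
          (starts-ends-count a D (trans (is-tent a) (tent-centre a)))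

agree-everywhere : ∀ {w} (f g : ℕ → ℕ) → (∀ (p : Fin w) → f (toℕ p) ≡ g (toℕ p)) →
  (∀ x → w ≤ x → f x ≡ g x) → ∀ x → f x ≡ g x
agree-everywhere {w} f g inside beyond x with x <? w
... | yes x<w = subst (λ y → f y ≡ g y) (toℕ-fromℕ< x<w) (inside (fromℕ< x<w))
... | no  x≮w = beyond x (≮⇒≥ x≮w)

tent-segmentation-size : ∀ a L → IsSegmentation (tentRow (suc a)) L → a + a ≤ length L
tent-segmentation-size a L (segs , sums) with as-intervals L segs
... | D , len≡ , sum≡ = subst (a + a ≤_) len≡ (tent-intervals a D
  (agree-everywhere (profile D) (tent a) (λ p → trans (sym (sum≡ p)) (sums p))
                    (λ x w≤x → trans (profile-beyond D x w≤x) (sym (tent-beyond a x w≤x)))))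

spike-segmentation-size : ∀ a L → IsSegmentation (spikeRow (suc a)) L → 1 ≤ length L
spike-segmentation-size a []      (_ , sums) = contradiction
  (trans (sums (middle a)) (trans (cong (spike a) (toℕ-fromℕ< (middle<width a))) (spike-centre a)))
  (λ ())
spike-segmentation-size a (_ ∷ _) _          = s≤s z≤n

P-segmentation-size : ∀ a (c : Bool) L →
  IsSegmentation (if c then spikeRow (suc a) else tentRow (suc a)) L → (if c then 1 else a + a) ≤ length L
P-segmentation-size a true  L = spike-segmentation-size a L
P-segmentation-size a false L = tent-segmentation-size a L

scale-segment : ∀ {w} c {S : Row w} → 0 < c → IsSegment S → IsSegment (scale c S)
scale-segment c {S} c>0 (v , v>0 , i , j , i≤j , j<w , shape) =
  c * v , *-mono-< c>0 v>0 , i , j , i≤j , j<w , λ p → scaled p (shape p)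
  where
  scaled : ∀ p → ((i ≤ toℕ p) × (toℕ p ≤ j) × (S p ≡ v)) ⊎ ((¬ ((i ≤ toℕ p) × (toℕ p ≤ j))) × (S p ≡ 0)) →
    ((i ≤ toℕ p) × (toℕ p ≤ j) × (c * S p ≡ c * v)) ⊎ ((¬ ((i ≤ toℕ p) × (toℕ p ≤ j))) × (c * S p ≡ 0))
  scaled p (inj₁ (i≤p , p≤j , e)) = inj₁ (i≤p , p≤j , cong (c *_) e)
  scaled p (inj₂ (p∉ , e))        = inj₂ (p∉ , trans (cong (c *_) e) (*-zeroʳ c))

sumRows-++ : ∀ {w} (L M : List (Row w)) p → sumRows (L ++ M) p ≡ sumRows L p + sumRows M p
sumRows-++ []      M p = refl
sumRows-++ (S ∷ L) M p = trans (cong (S p +_) (sumRows-++ L M p)) (sym (+-assoc (S p) _ _))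

sumRows-scale : ∀ {w} c (L : List (Row w)) p → sumRows (map (scale c) L) p ≡ c * sumRows L p
sumRows-scale c []      p = sym (*-zeroʳ c)
sumRows-scale c (S ∷ L) p = trans (cong (c * S p +_) (sumRows-scale c L p)) (sym (*-distribˡ-+ c (S p) _))

concat-tabulate-sum : ∀ {w} m (G : Fin m → List (Row w)) p →
  sumRows (concat (tabulate G)) p ≡ sumFin m (λ ℓ → sumRows (G ℓ) p)
concat-tabulate-sum zero    G p = refl
concat-tabulate-sum (suc m) G p = trans (sumRows-++ (G Fin.zero) _ p)
  (cong (sumRows (G Fin.zero) p +_) (concat-tabulate-sum m (G ∘ Fin.suc) p))

concat-tabulate-length : ∀ {w} m (G : Fin m → List (Row w)) →
  length (concat (tabulate G)) ≡ sumFin m (λ ℓ → length (G ℓ))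
concat-tabulate-length zero    G = refl
concat-tabulate-length (suc m) G = trans (length-++ (G Fin.zero))
  (cong (length (G Fin.zero) +_) (concat-tabulate-length m (G ∘ Fin.suc)))

block : ∀ b k → (Fin (suc k) → List (Row (width b))) → Fin (suc k) → List (Row (width b))
block b k Ss ℓ = map (scale (b ^ toℕ ℓ)) (Ss ℓ)

combine-blocks : ∀ b k Ss → combine b k Ss ≡ concat (tabulate (block b k Ss))
combine-blocks b k Ss = cong concat (map-tabulate (λ ℓ → ℓ) (block b k Ss))

combine-segmentation : ∀ b .{{_ : NonZero b}} k Ss → (∀ ℓ → IsSegmentation (P b k ℓ) (Ss ℓ)) →
  IsSegmentation (T b k) (combine b k Ss)
combine-segmentation b k Ss segs rewrite combine-blocks b k Ss =
  concat⁺ (tabulate⁺ (λ ℓ → map⁺ (All-map (scale-segment (b ^ toℕ ℓ) (m^n>0 b (toℕ ℓ))) (proj₁ (segs ℓ))))) ,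
  λ p → trans (concat-tabulate-sum (suc k) (block b k Ss) p) (sumFin-ext (suc k) (λ ℓ →
          trans (sumRows-scale (b ^ toℕ ℓ) (Ss ℓ) p) (cong (b ^ toℕ ℓ *_) (proj₂ (segs ℓ) p))))

last-count : ∀ k t → sumFin (suc k) (λ ℓ → if toℕ ℓ ≡ᵇ k then 1 else t) ≡ k * t + 1
last-count zero    t = refl
last-count (suc k) t = trans (cong (t +_) (last-count k t)) (sym (+-assoc t (k * t) 1))

combine-size : ∀ a k Ss → (∀ ℓ → IsSegmentation (P (suc a) k ℓ) (Ss ℓ)) →
  (a + a) * k + 1 ≤ size (combine (suc a) k Ss)
combine-size a k Ss segs = begin
  (a + a) * k + 1  ≡⟨ cong (_+ 1) (*-comm (a + a) k) ⟩
  k * (a + a) + 1  ≡⟨ sym (last-count k (a + a)) ⟩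
  sumFin (suc k) (λ ℓ → if toℕ ℓ ≡ᵇ k then 1 else a + a)
    ≤⟨ sumFin-mono (suc k) (λ ℓ → ≤-trans (P-segmentation-size a (toℕ ℓ ≡ᵇ k) (Ss ℓ) (segs ℓ))
                                          (≤-reflexive (sym (length-map (scale (suc a ^ toℕ ℓ)) (Ss ℓ))))) ⟩
  sumFin (suc k) (λ ℓ → length (block (suc a) k Ss ℓ))
    ≡⟨ sym (concat-tabulate-length (suc k) (block (suc a) k Ss)) ⟩
  length (concat (tabulate (block (suc a) k Ss)))
    ≡⟨ cong length (sym (combine-blocks (suc a) k Ss)) ⟩
  size (combine (suc a) k Ss) ∎
  where open ≤-Reasoning

largest-entry : ∀ a k → (∀ p → T (suc a) k p ≤ suc a ^ k) × (∃ λ p → T (suc a) k p ≡ suc a ^ k)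
largest-entry a k =
  (λ p → ≤-trans (≤-reflexive (T-closed a k p)) (level-bound a k (toℕ p))) ,
  (middle a , trans (T-closed a k (middle a))
                    (trans (cong (level a k) (toℕ-fromℕ< (middle<width a))) (level-centre a k)))

two-b-minus-two : ∀ a → 2 * suc a ∸ 2 ≡ a + a
two-b-minus-two a rewrite +-identityʳ a | +-suc a a = refl

theorem3 : (b k : ℕ) → 2 ≤ b → 1 ≤ k →
    ((∀ p → T b k p ≤ b ^ k) × (∃ λ p → T b k p ≡ b ^ k)) ×
    (∀ (Ss : Fin (suc k) → List (Row (width b))) →
      (∀ ℓ → IsSegmentation (P b k ℓ) (Ss ℓ)) →
      IsSegmentation (T b k) (combine b k Ss) ×
      (∀ (O : List (Row (width b))) → IsOptimalSegmentation (T b k) O →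
        ((2 * b ∸ 2) * k + 1) * size O ≤ b * size (combine b k Ss)))
theorem3 zero    k () _
theorem3 (suc a) k _ k≥1 = largest-entry a k , λ Ss segs →
  combine-segmentation (suc a) k Ss segs , λ O (_ , minimal) → begin
    ((2 * suc a ∸ 2) * k + 1) * size O  ≡⟨ cong (λ c → (c * k + 1) * size O) (two-b-minus-two a) ⟩
    ((a + a) * k + 1) * size O          ≤⟨ *-monoʳ-≤ ((a + a) * k + 1) (opt≤b O minimal) ⟩
    ((a + a) * k + 1) * suc a           ≡⟨ *-comm ((a + a) * k + 1) (suc a) ⟩
    suc a * ((a + a) * k + 1)           ≤⟨ *-monoʳ-≤ (suc a) (combine-size a k Ss segs) ⟩
    suc a * size (combine (suc a) k Ss) ∎
  where
  open ≤-Reasoning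
  opt≤b : ∀ O → (∀ L → IsSegmentation (T (suc a) k) L → size O ≤ size L) → size O ≤ suc a
  opt≤b O minimal = ≤-trans (minimal _ (explicit-segmentation a k k≥1))
                          (≤-reflexive (explicit-size a (repunit (suc a) k)))
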